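{- There exists a periodic graph $\mathcal{G}$ with $c(\mathcal{G})=1$ whose footprint $G$ satisfies $c(G)=3$.
   Context: All graphs are finite, undirected and reflexive. A periodic graph with period $p\ge1$ is a sequence $\mathcal{G}=(G_0,\dots,G_{p-1})$ of graphs $G_i=(V,E_i)$ on a common vertex set, extended by $G_{i+p}=G_i$; its footprint is $G=(V,\bigcup_iE_i)$, assumed connected. Cops and Robber on $\mathcal{G}$ with $k$ cops (perfect information): cops choose starting vertices, then the robber; in each round $t=0,1,\dots$ each cop moves to a vertex of $N_{G_{t\bmod p}}[\text{its position}]$, then the robber likewise; the cops win if a cop ever moves onto the robber's vertex. The cop number $c(\cdot)$ is the least $k$ such that $k$ cops have a winning strategy; for a static graph it is the usual cop number. -}

module Defs where

open import Data.Nat using (ℕ; zero; suc; NonZero; _<_)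
open import Data.Nat.DivMod using (_mod_)
open import Data.Fin using (Fin)
open import Data.Bool using (Bool; true; false; _∨_)
open import Data.Product using (Σ; _×_; _,_)
open import Data.Sum using (_⊎_)
open import Relation.Nullary using (¬_)
open import Relation.Binary.PropositionalEquality using (_≡_)

-- Adjacency (closed-neighbourhood) relation on the vertex set Fin n.
Adj : ℕ → Set
Adj n = Fin n → Fin n → Bool

IsGraph : {n : ℕ} → Adj n → Set
IsGraph {n} A = (∀ v → A v v ≡ true) × (∀ u v → A u v ≡ A v u)

record PeriodicGraph (n : ℕ) : Set where
  field
    period       : ℕ
    period-nz    : NonZero period
    layer        : Fin period → Adj n
    layer-graph  : ∀ i → IsGraph (layer i)
open PeriodicGraph public

graphAt : {n : ℕ} → PeriodicGraph n → ℕ → Adj n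
graphAt 𝒢 t = layer 𝒢 (_mod_ t (period 𝒢) {{period-nz 𝒢}})

anyFin : (p : ℕ) → (Fin p → Bool) → Bool
anyFin zero    f = false
anyFin (suc p) f = f Fin.zero ∨ anyFin p (λ i → f (Fin.suc i))

footprint : {n : ℕ} → PeriodicGraph n → Adj n
footprint 𝒢 u v = anyFin (period 𝒢) (λ i → layer 𝒢 i u v)

data Reach {n : ℕ} (A : Adj n) : Fin n → Fin n → Set where
  here : ∀ {u} → Reach A u u
  step : ∀ {u w v} → A u w ≡ true → Reach A w v → Reach A u v

Connected : {n : ℕ} → Adj n → Set
Connected {n} A = ∀ (u v : Fin n) → Reach A u v

-- CopsWinFrom Gt t cs r : at the start of round t, cops at cs, robber at r,
-- the cops can force a capture (least fixed point = winning region of the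
-- reachability game, i.e. cops have a winning strategy from this position).
data CopsWinFrom {n k : ℕ} (Gt : ℕ → Adj n) : ℕ → (Fin k → Fin n) → Fin n → Set where
  move : ∀ {t cs r} (cs' : Fin k → Fin n) →
         (∀ i → Gt t (cs i) (cs' i) ≡ true) →
         ((Σ (Fin k) λ i → cs' i ≡ r) ⊎
          (∀ r' → Gt t r r' ≡ true → CopsWinFrom Gt (suc t) cs' r')) →
         CopsWinFrom Gt t cs r

CopsWin : {n : ℕ} → (ℕ → Adj n) → ℕ → Set
CopsWin {n} Gt k = Σ (Fin k → Fin n) λ cs → ∀ (r : Fin n) → CopsWinFrom Gt 0 cs r

HasCopNumber : {n : ℕ} → (ℕ → Adj n) → ℕ → Set
HasCopNumber Gt k = CopsWin Gt k × (∀ j → j < k → ¬ CopsWin Gt j)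

static : {n : ℕ} → Adj n → ℕ → Adj n
static A t = A

{-# OPTIONS --safe #-}
-- The footprint is the Petersen graph, whose cop number is 3: the vertices 0, 2, 6
-- dominate it, while against two cops the robber can always move to a vertex
-- adjacent to neither (as in any graph of girth 5 and minimum degree 3; here this
-- is checked exhaustively). The periodic graph offers the 15 edges one per round,
-- so the robber can use at most one edge per round, and a single cop starting at
-- vertex 0 catches it within ten rounds. This is verified by computing, by backward
-- induction over the rounds, the positions from which the cop wins in time.
module Submission where

open import Defs
open import Data.Bool using (Bool; true; false; _∧_; _∨_; not; T; if_then_else_)
open import Data.Bool.Properties using (T-≡; T-∧; T-∨; ∨-comm)
open import Data.Empty using (⊥; ⊥-elim)
open import Data.Fin using (Fin; zero; suc; #_; _≟_; fromℕ<)
open import Data.Nat using (ℕ; zero; suc; _≤′_; ≤′-refl; ≤′-step; s≤s⁻¹; >-nonZero⁻¹)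
open import Data.Nat.Properties using (≤⇒≤′)
open import Data.Product using (Σ; _×_; _,_; proj₁; proj₂; map₂)
open import Data.Sum using (inj₁; inj₂)
open import Data.Vec using (Vec; []; _∷_; lookup; tabulate)
open import Data.Vec.Properties using (lookup∘tabulate)
import Data.Vec.Functional as Vector
open import Function.Bundles using (module Equivalence)
open import Relation.Nullary using (¬_; yes; no)
open import Relation.Nullary.Decidable using (⌊_⌋; toWitness; fromWitness)
open import Relation.Binary.PropositionalEquality using (_≡_; refl; sym; trans; cong; cong₂; subst)

open Equivalence using (to; from)

private
  variable
    n k : ℕ

allFin : (n : ℕ) → (Fin n → Bool) → Bool
allFin zero    f = true
allFin (suc n) f = f zero ∧ allFin n (λ i → f (suc i))

allFin-sound : ∀ n {f : Fin n → Bool} → T (allFin n f) → ∀ i → T (f i)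
allFin-sound (suc n) h zero    = proj₁ (to T-∧ h)
allFin-sound (suc n) h (suc i) = allFin-sound n (proj₂ (to T-∧ h)) i

anyFin-sound : ∀ n {f : Fin n → Bool} → T (anyFin n f) → Σ (Fin n) λ i → T (f i)
anyFin-sound (suc n) h with to T-∨ h
... | inj₁ h₀ = zero , h₀
... | inj₂ hₛ with anyFin-sound n hₛ
...   | i , hᵢ = suc i , hᵢ

anyFin-complete : ∀ n {f : Fin n → Bool} i → T (f i) → T (anyFin n f)
anyFin-complete (suc n) zero    h = from T-∨ (inj₁ h)
anyFin-complete (suc n) (suc i) h = from T-∨ (inj₂ (anyFin-complete n i h))

infixr 1 _⇒ᵇ_
_⇒ᵇ_ : Bool → Bool → Bool
true  ⇒ᵇ y = y
false ⇒ᵇ _ = true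

⇒ᵇ-elim : ∀ {x y} → T (x ⇒ᵇ y) → T x → T y
⇒ᵇ-elim {true} h _ = h

not-elim : ∀ {x} → T (not x) → x ≡ true → ⊥
not-elim h refl = h

CanStay : (ℕ → Adj n) → Set
CanStay {n} G = ∀ t (v : Fin n) → G t v v ≡ true

module _ {G : ℕ → Adj n} (stay : CanStay G) where

  no-cops-lose : ∀ {t cs r} → ¬ CopsWinFrom {k = 0} G t cs r
  no-cops-lose (move _ _ (inj₁ (() , _)))
  no-cops-lose {t} {r = r} (move _ _ (inj₂ next)) = no-cops-lose (next r (stay t r))

  parked : ∀ (v : Fin n) {t} {cs cs′ : Fin k → Fin n} → (∀ i → G t (cs i) (cs′ i) ≡ true) →
           ∀ i → G t ((v Vector.∷ cs) i) ((v Vector.∷ cs′) i) ≡ true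
  parked v {t} legal zero    = stay t v
  parked v     legal (suc i) = legal i

  add-cop : ∀ (v : Fin n) {t cs r} → CopsWinFrom {k = k} G t cs r → CopsWinFrom G t (v Vector.∷ cs) r
  add-cop v (move cs′ legal (inj₁ (i , caught))) =
    move (v Vector.∷ cs′) (parked v legal) (inj₁ (suc i , caught))
  add-cop v (move cs′ legal (inj₂ next)) =
    move (v Vector.∷ cs′) (parked v legal) (inj₂ λ r′ adj → add-cop v (next r′ adj))

  more-cops : ∀ {j} → Fin n → j ≤′ k → CopsWin G j → CopsWin G k
  more-cops v ≤′-refl        win = win
  more-cops v (≤′-step j≤k) win with more-cops v j≤k win
  ... | cs , wins = (v Vector.∷ cs) , λ r → add-cop v (wins r)

  hasCopNumber : Fin n → CopsWin G (suc k) → ¬ CopsWin G k → HasCopNumber G (suc k)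
  hasCopNumber v win lose = win , λ j j<1+k wj → lose (more-cops v (≤⇒≤′ (s≤s⁻¹ j<1+k)) wj)

-- Positions are tabulated rather than given as functions so that Agda's call-by-need
-- evaluation computes each entry once; this keeps the exhaustive checks below fast.
Table : ℕ → Set
Table n = Vec (Vec Bool n) n

_⟨_,_⟩ : Table n → Fin n → Fin n → Bool
W ⟨ c , r ⟩ = lookup (lookup W c) r

tabulate₂ : (Fin n → Fin n → Bool) → Table n
tabulate₂ f = tabulate λ c → tabulate (f c)

lookup∘tabulate₂ : ∀ (f : Fin n → Fin n → Bool) c r → tabulate₂ f ⟨ c , r ⟩ ≡ f c r
lookup∘tabulate₂ f c r = trans (cong (λ row → lookup row r) (lookup∘tabulate _ c)) (lookup∘tabulate (f c) r)

catchesOrTraps : Adj n → Table n → Fin n → Fin n → Bool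
catchesOrTraps {n} A W c r =
  anyFin n λ c′ → A c c′ ∧ (⌊ c′ ≟ r ⌋ ∨ allFin n λ r′ → A r r′ ⇒ᵇ W ⟨ c′ , r′ ⟩)

captureWithin : (ℕ → Adj n) → ℕ → ℕ → Table n
captureWithin G zero    t = tabulate₂ λ _ _ → false
captureWithin G (suc m) t = tabulate₂ (catchesOrTraps (G t) (captureWithin G m (suc t)))

captureWithin-sound : ∀ (G : ℕ → Adj n) m t c r →
                      T (captureWithin G m t ⟨ c , r ⟩) → CopsWinFrom {k = 1} G t (λ _ → c) r
captureWithin-sound G zero t c r h = ⊥-elim (subst T (lookup∘tabulate₂ _ c r) h)
captureWithin-sound {n} G (suc m) t c r h
  with anyFin-sound n (subst T (lookup∘tabulate₂ (catchesOrTraps (G t) (captureWithin G m (suc t))) c r) h)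
... | c′ , h′ with to T-∧ h′
...   | legal , outcome with to T-∨ outcome
...     | inj₁ caught  = move (λ _ → c′) (λ _ → to T-≡ legal) (inj₁ (zero , toWitness caught))
...     | inj₂ trapped = move (λ _ → c′) (λ _ → to T-≡ legal) (inj₂ λ r′ adj →
          captureWithin-sound G m (suc t) c′ r′ (⇒ᵇ-elim (allFin-sound n trapped r′) (from T-≡ adj)))

captureWithin-wins : ∀ (G : ℕ → Adj n) m c →
                     T (allFin n λ r → captureWithin G m 0 ⟨ c , r ⟩) → CopsWin G 1
captureWithin-wins {n} G m c h = (λ _ → c) , λ r → captureWithin-sound G m 0 c r (allFin-sound n h r)

module Evasion {k} (A : Adj n) (Safe : (Fin k → Fin n) → Fin n → Set)
  (unseen : ∀ {cs r} → Safe cs r → ∀ i → A (cs i) r ≡ true → ⊥)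
  (evade : ∀ {cs r cs′} → Safe cs r → (∀ i → A (cs i) (cs′ i) ≡ true) →
           Σ (Fin n) λ r′ → A r r′ ≡ true × Safe cs′ r′)
  where

  evades : ∀ {t cs r} → Safe cs r → ¬ CopsWinFrom (static A) t cs r
  evades safe (move cs′ legal (inj₁ (i , caught))) =
    unseen safe i (subst (λ x → A _ x ≡ true) caught (legal i))
  evades safe (move cs′ legal (inj₂ next)) with evade safe legal
  ... | r′ , adj , safe′ = evades safe′ (next r′ adj)

  copsLose : (∀ cs → Σ (Fin n) (Safe cs)) → ¬ CopsWin (static A) k
  copsLose hide (cs , wins) with hide cs
  ... | r , safe = evades safe (wins r)

unguarded : Table n → Fin n → Fin n → Fin n → Bool
unguarded M c₁ c₂ r = not (M ⟨ c₁ , r ⟩) ∧ not (M ⟨ c₂ , r ⟩)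

canHide : Table n → Bool
canHide {n} M = allFin n λ c₁ → allFin n λ c₂ → anyFin n (unguarded M c₁ c₂)

canEvade : Table n → Bool
canEvade {n} M =
  allFin n λ c₁ → allFin n λ c₂ → allFin n λ r → unguarded M c₁ c₂ r ⇒ᵇ
  allFin n λ c₁′ → M ⟨ c₁ , c₁′ ⟩ ⇒ᵇ allFin n λ c₂′ → M ⟨ c₂ , c₂′ ⟩ ⇒ᵇ
  anyFin n λ r′ → M ⟨ r , r′ ⟩ ∧ unguarded M c₁′ c₂′ r′

canEvade-sound : ∀ (M : Table n) → T (canEvade M) →
                 ∀ {c₁ c₂ r c₁′ c₂′} →
                 T (unguarded M c₁ c₂ r) → T (M ⟨ c₁ , c₁′ ⟩) → T (M ⟨ c₂ , c₂′ ⟩) →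
                 Σ (Fin n) λ r′ → T (M ⟨ r , r′ ⟩) × T (unguarded M c₁′ c₂′ r′)
canEvade-sound {n} M h {c₁} {c₂} {r} {c₁′} {c₂′} safe adj₁ adj₂ =
  map₂ (to (T-∧ {M ⟨ r , _ ⟩})) (anyFin-sound n
    (⇒ᵇ-elim (allFin-sound n (⇒ᵇ-elim (allFin-sound n
      (⇒ᵇ-elim (allFin-sound n (allFin-sound n (allFin-sound n h c₁) c₂) r) safe) c₁′) adj₁) c₂′) adj₂))

tabulate₂-T : ∀ (A : Adj n) {u v} → A u v ≡ true → T (tabulate₂ A ⟨ u , v ⟩)
tabulate₂-T A {u} {v} adj = from T-≡ (trans (lookup∘tabulate₂ A u v) adj)

T-tabulate₂ : ∀ (A : Adj n) {u v} → T (tabulate₂ A ⟨ u , v ⟩) → A u v ≡ true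
T-tabulate₂ A {u} {v} h = trans (sym (lookup∘tabulate₂ A u v)) (to T-≡ h)

two-cops-lose : (A : Adj n) → T (canHide (tabulate₂ A)) → T (canEvade (tabulate₂ A)) → ¬ CopsWin (static A) 2
two-cops-lose {n} A hides escapes = Evasion.copsLose A Safe unseen evade hide
  where
    M : Table n
    M = tabulate₂ A

    Safe : (Fin 2 → Fin n) → Fin n → Set
    Safe cs r = T (unguarded M (cs zero) (cs (suc zero)) r)

    unseen : ∀ {cs r} → Safe cs r → ∀ i → A (cs i) r ≡ true → ⊥
    unseen safe zero       adj = not-elim (proj₁ (to T-∧ safe)) (to T-≡ (tabulate₂-T A adj))
    unseen safe (suc zero) adj = not-elim (proj₂ (to T-∧ safe)) (to T-≡ (tabulate₂-T A adj))

    evade : ∀ {cs r cs′} → Safe cs r → (∀ i → A (cs i) (cs′ i) ≡ true) →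
            Σ (Fin n) λ r′ → A r r′ ≡ true × Safe cs′ r′
    evade safe legal
      with canEvade-sound M escapes safe (tabulate₂-T A (legal zero)) (tabulate₂-T A (legal (suc zero)))
    ... | r′ , adj , safe′ = r′ , T-tabulate₂ A adj , safe′

    hide : ∀ cs → Σ (Fin n) (Safe cs)
    hide cs = anyFin-sound n (allFin-sound n (allFin-sound n hides (cs zero)) (cs (suc zero)))

dominates : Adj n → (Fin k → Fin n) → Bool
dominates {n} {k} A D = allFin n λ r → anyFin k λ i → A (D i) r

dominating-set-wins : (A : Adj n) → (∀ v → A v v ≡ true) → (D : Fin k → Fin n) →
                      T (dominates A D) → CopsWin (static A) k
dominating-set-wins {n} {k} A reflexive D dom =
  D , λ r → pounce r (anyFin-sound k (allFin-sound n dom r))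
  where
    pounce : ∀ r → Σ (Fin k) (λ i → T (A (D i) r)) → CopsWinFrom (static A) 0 D r
    pounce r (i , adj) = move jump legal (inj₁ (i , hit))
      where
        jump : Fin k → Fin n
        jump j = if A (D j) r then r else D j
        legal : ∀ j → A (D j) (jump j) ≡ true
        legal j with A (D j) r in eq
        ... | true  = eq
        ... | false = reflexive (D j)
        hit : jump i ≡ r
        hit rewrite to T-≡ adj = refl

withinSteps : Adj n → ℕ → Fin n → Fin n → Bool
withinSteps A zero    u v = ⌊ u ≟ v ⌋
withinSteps A (suc d) u v = anyFin _ λ w → A u w ∧ withinSteps A d w v

withinSteps-sound : ∀ (A : Adj n) d {u v} → T (withinSteps A d u v) → Reach A u v
withinSteps-sound A zero    h rewrite toWitness h = here
withinSteps-sound A (suc d) {u} h with anyFin-sound _ h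
... | w , h′ = step (to T-≡ (proj₁ (to (T-∧ {A u w}) h′)))
                    (withinSteps-sound A d (proj₂ (to (T-∧ {A u w}) h′)))

hasDiameter≤ : Adj n → ℕ → Bool
hasDiameter≤ {n} A d = allFin n λ u → allFin n λ v → withinSteps A d u v

connected : ∀ (A : Adj n) d → T (hasDiameter≤ A d) → Connected A
connected {n} A d h u v = withinSteps-sound A d (allFin-sound n (allFin-sound n h u) v)

⌊≟⌋-sym : ∀ (u v : Fin n) → ⌊ u ≟ v ⌋ ≡ ⌊ v ≟ u ⌋
⌊≟⌋-sym u v with u ≟ v | v ≟ u
... | yes _   | yes _   = refl
... | no  _   | no  _   = refl
... | yes u≡v | no  v≢u = ⊥-elim (v≢u (sym u≡v))
... | no  u≢v | yes v≡u = ⊥-elim (u≢v (sym v≡u))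

joins : Fin n × Fin n → Fin n → Fin n → Bool
joins (a , b) u v = ⌊ u ≟ a ⌋ ∧ ⌊ v ≟ b ⌋

edgeGraph : Fin n × Fin n → Adj n
edgeGraph e u v = ⌊ u ≟ v ⌋ ∨ joins e u v ∨ joins e v u

edgeGraph-isGraph : ∀ (e : Fin n × Fin n) → IsGraph (edgeGraph e)
edgeGraph-isGraph e = reflexive , symmetric
  where
    reflexive : ∀ v → edgeGraph e v v ≡ true
    reflexive v = to T-≡ (from T-∨ (inj₁ (fromWitness {a? = v ≟ v} refl)))
    symmetric : ∀ u v → edgeGraph e u v ≡ edgeGraph e v u
    symmetric u v = cong₂ _∨_ (⌊≟⌋-sym u v) (∨-comm (joins e u v) (joins e v u))

edgeSequence : ∀ {p} → Vec (Fin n × Fin n) (suc p) → PeriodicGraph n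
edgeSequence {p = p} edges = record
  { period      = suc p
  ; period-nz   = _
  ; layer       = λ i → edgeGraph (lookup edges i)
  ; layer-graph = λ i → edgeGraph-isGraph (lookup edges i)
  }

graphAt-canStay : (𝒢 : PeriodicGraph n) → CanStay (graphAt 𝒢)
graphAt-canStay 𝒢 t = proj₁ (layer-graph 𝒢 _)

footprint-reflexive : (𝒢 : PeriodicGraph n) → ∀ v → footprint 𝒢 v v ≡ true
footprint-reflexive 𝒢 v = to T-≡ (anyFin-complete (period 𝒢) i (from T-≡ (proj₁ (layer-graph 𝒢 i) v)))
  where
    i : Fin (period 𝒢)
    i = fromℕ< (>-nonZero⁻¹ (period 𝒢) {{period-nz 𝒢}})

petersenEdges : Vec (Fin 10 × Fin 10) 15
petersenEdges =
  (# 0 , # 1) ∷ (# 1 , # 2) ∷ (# 2 , # 3) ∷ (# 3 , # 4) ∷ (# 4 , # 0) ∷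
  (# 0 , # 5) ∷ (# 1 , # 6) ∷ (# 2 , # 7) ∷ (# 3 , # 8) ∷ (# 4 , # 9) ∷
  (# 5 , # 7) ∷ (# 6 , # 8) ∷ (# 7 , # 9) ∷ (# 8 , # 5) ∷ (# 9 , # 6) ∷ []

petersenTour : PeriodicGraph 10
petersenTour = edgeSequence petersenEdges

petersen : Adj 10
petersen = footprint petersenTour

corollary1 : Σ ℕ λ n → Σ (PeriodicGraph n) λ 𝒢 →
    Connected (footprint 𝒢) × HasCopNumber (graphAt 𝒢) 1 × HasCopNumber (static (footprint 𝒢)) 3
corollary1 = 10 , petersenTour , connected petersen 2 _ , onTour , onFootprint
  where
    onTour : HasCopNumber (graphAt petersenTour) 1
    onTour = hasCopNumber (graphAt-canStay petersenTour) zero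
      (captureWithin-wins (graphAt petersenTour) 10 zero _)
      (λ (_ , wins) → no-cops-lose (graphAt-canStay petersenTour) (wins zero))
    onFootprint : HasCopNumber (static petersen) 3
    onFootprint = hasCopNumber (λ _ → footprint-reflexive petersenTour) zero
      (dominating-set-wins petersen (footprint-reflexive petersenTour) (lookup (# 0 ∷ # 2 ∷ # 6 ∷ [])) _)
      (two-cops-lose petersen _ _)
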